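{- The map $\min:\mathbf{COrd}\times\mathbf{COrd}\to\mathbf{COrd}$, $(\alpha,\beta)\mapsto\min\{\alpha,\beta\}$, is computable.
   Context: A represented space is a pair $(X,\delta_X)$ with $\delta_X:\subseteq\mathbb{N}^\mathbb{N}\to X$ a partial surjection; a function between represented spaces is computable if some computable $F:\subseteq\mathbb{N}^\mathbb{N}\to\mathbb{N}^\mathbb{N}$ maps names of inputs to names of outputs. Products are represented via a standard pairing $\langle p,q\rangle$. $\mathbf{COrd}=(\mathrm{cord},\delta_{\mathrm{nK}})$ is the set of countable ordinals with the representation defined inductively by $\delta_{\mathrm{nK}}(0p)=0$, $\delta_{\mathrm{nK}}(1p)=\delta_{\mathrm{nK}}(p)+1$, $\delta_{\mathrm{nK}}(2\langle p_0,p_1,\ldots\rangle)=\sup_{i}\delta_{\mathrm{nK}}(p_i)$, where $\langle p_0,p_1,\ldots\rangle$ is a standard computable tupling on $\mathbb{N}^\mathbb{N}$. -}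

module Defs where

open import Data.Nat using (ℕ; zero; suc; _+_; _<_)
open import Data.Fin using (Fin)
open import Data.Vec using (Vec; []; _∷_; lookup)
open import Data.Product using (Σ; ∃; _×_)
open import Data.Sum using (_⊎_)
open import Relation.Binary.PropositionalEquality using (_≡_)

Baire : Set
Baire = ℕ → ℕ

hd : Baire → ℕ
hd p = p 0

tl : Baire → Baire
tl p n = p (suc n)

-- standard pairing ⟨p,q⟩ on Baire space: ⟨p,q⟩(2n) = p n, ⟨p,q⟩(2n+1) = q n
⟪_,_⟫ : Baire → Baire → Baire
⟪ p , q ⟫ zero          = p zero
⟪ p , q ⟫ (suc zero)    = q zero
⟪ p , q ⟫ (suc (suc n)) = ⟪ tl p , tl q ⟫ n

-- Cantor pairing on ℕ:  π(i,j) = (i+j)(i+j+1)/2 + j  (a bijection ℕ×ℕ → ℕ)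
tri : ℕ → ℕ
tri zero    = zero
tri (suc k) = tri k + suc k

cpair : ℕ → ℕ → ℕ
cpair i j = tri (i + j) + j

-- the standard computable tupling ⟨p₀,p₁,…⟩(π(i,j)) = pᵢ(j);
-- `component i r` is the i-th sequence coded by r.
component : ℕ → Baire → Baire
component i r j = r (cpair i j)

data Code : ℕ → Set where
  zer    : ∀ {n} → Code n
  succ   : Code 1
  proj   : ∀ {n} → Fin n → Code n
  oracle : Code 1
  comp   : ∀ {m n} → Code m → Vec (Code n) m → Code n
  prec   : ∀ {n} → Code n → Code (suc (suc n)) → Code (suc n)
  mu     : ∀ {n} → Code (suc n) → Code n

mutual
  data Eval (p : Baire) : ∀ {n} → Code n → Vec ℕ n → ℕ → Set where
    ev-zer    : ∀ {n} {xs : Vec ℕ n} → Eval p zer xs 0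
    ev-succ   : ∀ {x} → Eval p succ (x ∷ []) (suc x)
    ev-proj   : ∀ {n} {i : Fin n} {xs} → Eval p (proj i) xs (lookup xs i)
    ev-oracle : ∀ {x} → Eval p oracle (x ∷ []) (p x)
    ev-comp   : ∀ {m n} {f : Code m} {gs : Vec (Code n) m} {xs ys v} →
                EvalVec p gs xs ys → Eval p f ys v → Eval p (comp f gs) xs v
    ev-prec0  : ∀ {n} {f : Code n} {g} {xs v} →
                Eval p f xs v → Eval p (prec f g) (0 ∷ xs) v
    ev-precS  : ∀ {n} {f : Code n} {g} {k xs u v} →
                Eval p (prec f g) (k ∷ xs) u → Eval p g (k ∷ u ∷ xs) v →
                Eval p (prec f g) (suc k ∷ xs) v
    ev-mu     : ∀ {n} {f : Code (suc n)} {xs k} →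
                Eval p f (k ∷ xs) 0 →
                (∀ j → j < k → Σ ℕ λ v → Eval p f (j ∷ xs) (suc v)) →
                Eval p (mu f) xs k

  data EvalVec (p : Baire) {n : ℕ} : ∀ {m} → Vec (Code n) m → Vec ℕ n → Vec ℕ m → Set where
    []  : ∀ {xs} → EvalVec p [] xs []
    _∷_ : ∀ {m} {g : Code n} {gs : Vec (Code n) m} {xs y ys} →
          Eval p g xs y → EvalVec p gs xs ys → EvalVec p (g ∷ gs) xs (y ∷ ys)

Computes : Code 1 → Baire → Baire → Set
Computes e p r = ∀ n → Eval p e (n ∷ []) (r n)

data Ord : Set where
  zero : Ord
  suc  : Ord → Ord
  lim  : (ℕ → Ord) → Ord

-- the ordinal order on Brouwer trees (lim f denotes sup_i f i)
data _≤ₒ_ : Ord → Ord → Set where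
  z≤     : ∀ {b} → zero ≤ₒ b
  s≤s    : ∀ {a b} → a ≤ₒ b → suc a ≤ₒ suc b
  ≤suc   : ∀ {a b} → a ≤ₒ b → a ≤ₒ suc b
  ≤lim   : ∀ {a f} i → a ≤ₒ f i → a ≤ₒ lim f
  lim≤   : ∀ {f b} → (∀ i → f i ≤ₒ b) → lim f ≤ₒ b
  ≤trans : ∀ {a b c} → a ≤ₒ b → b ≤ₒ c → a ≤ₒ c

_≈ₒ_ : Ord → Ord → Set
a ≈ₒ b = a ≤ₒ b × b ≤ₒ a

IsMin : Ord → Ord → Ord → Set
IsMin γ α β = (γ ≈ₒ α ⊎ γ ≈ₒ β) × γ ≤ₒ α × γ ≤ₒ β

-- The representation δ_nK : NameOf p α  means  δ_nK(p) = α

data NameOf (p : Baire) : Ord → Set where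
  nm-zero : hd p ≡ 0 → NameOf p zero
  nm-suc  : ∀ {α} → hd p ≡ 1 → NameOf (tl p) α → NameOf p (suc α)
  nm-lim  : ∀ {f} → hd p ≡ 2 → (∀ i → NameOf (component i (tl p)) (f i)) →
            NameOf p (lim f)

-- Entry 0 of a name of min{α,β} is determined by the heads of the names of α
-- and β: it is 0 if either head is 0, 1 if both are 1, and 2 if α is a limit,
-- or α a successor and β a limit. Entry 1+n is entry n of the tails, resp.
-- entry k of the i-th components when n = ⟨i,k⟩; so entry n is reached after
-- at most n descents into the two input names, each shrinking the index.
-- Recording the descents into each name as a coded stack makes this primitive
-- recursive in the oracle ⟪p,q⟫. Which of α, β the result equals cannot be
-- decided, hence excluded middle.

module Submission where

open import Defs
open import Level using (0ℓ)
open import Axiom.ExcludedMiddle using (ExcludedMiddle)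
open import Data.Nat using (ℕ; zero; suc; _+_; _∸_; pred; _≤_; _<_; z≤n; s≤s)
open import Data.Nat.Properties
open import Data.Nat.GeneralisedArithmetic using (iterate)
open import Data.Fin using (Fin; #_)
open import Data.Vec using (Vec; []; _∷_; lookup)
open import Data.Product using (Σ; _×_; _,_; proj₁; proj₂)
open import Data.Sum using (_⊎_; inj₁; inj₂)
open import Data.Empty using (⊥-elim)
open import Function using (_∘_)
open import Relation.Nullary using (yes; no)
open import Relation.Binary using (tri<; tri≈; tri>)
open import Relation.Binary.PropositionalEquality

Program : (n : ℕ) → (Baire → Vec ℕ n → ℕ) → Set
Program n f = Σ (Code n) λ e → ∀ o xs → Eval o e xs (f o xs)

program-cong : ∀ {n f g} → (∀ o xs → f o xs ≡ g o xs) → Program n f → Program n g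
program-cong f≡g (e , e-ok) = e , λ o xs → subst (Eval o e xs) (f≡g o xs) (e-ok o xs)

zeroᴾ : ∀ {n} → Program n (λ _ _ → 0)
zeroᴾ = zer , λ _ _ → ev-zer

sucᴾ : Program 1 (λ _ xs → suc (lookup xs (# 0)))
sucᴾ = succ , λ { _ (_ ∷ []) → ev-succ }

varᴾ : ∀ {n} (i : Fin n) → Program n (λ _ xs → lookup xs i)
varᴾ i = proj i , λ _ _ → ev-proj

oracleᴾ : Program 1 (λ o xs → o (lookup xs (# 0)))
oracleᴾ = oracle , λ { _ (_ ∷ []) → ev-oracle }

comp₁ : ∀ {n f g} → Program 1 f → Program n g → Program n (λ o xs → f o (g o xs ∷ []))
comp₁ (ef , f-ok) (eg , g-ok) = comp ef (eg ∷ []) , λ o xs → ev-comp (g-ok o xs ∷ []) (f-ok o _)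

comp₂ : ∀ {n f g h} → Program 2 f → Program n g → Program n h →
        Program n (λ o xs → f o (g o xs ∷ h o xs ∷ []))
comp₂ (ef , f-ok) (eg , g-ok) (eh , h-ok) =
  comp ef (eg ∷ eh ∷ []) , λ o xs → ev-comp (g-ok o xs ∷ h-ok o xs ∷ []) (f-ok o _)

comp₃ : ∀ {n f g h k} → Program 3 f → Program n g → Program n h → Program n k →
        Program n (λ o xs → f o (g o xs ∷ h o xs ∷ k o xs ∷ []))
comp₃ (ef , f-ok) (eg , g-ok) (eh , h-ok) (ek , k-ok) =
  comp ef (eg ∷ eh ∷ ek ∷ []) , λ o xs → ev-comp (g-ok o xs ∷ h-ok o xs ∷ k-ok o xs ∷ []) (f-ok o _)

recᴾ : ∀ {n f g h} → Program n f → Program (suc (suc n)) g →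
       (∀ o xs → h o (0 ∷ xs) ≡ f o xs) →
       (∀ o k xs → h o (suc k ∷ xs) ≡ g o (k ∷ h o (k ∷ xs) ∷ xs)) →
       Program (suc n) h
recᴾ {h = h} (ef , f-ok) (eg , g-ok) h-zero h-suc = prec ef eg , λ { o (k ∷ xs) → prec-ok o k xs }
  where
  prec-ok : ∀ o k xs → Eval o (prec ef eg) (k ∷ xs) (h o (k ∷ xs))
  prec-ok o zero    xs = subst (Eval o _ _) (sym (h-zero o xs)) (ev-prec0 (f-ok o xs))
  prec-ok o (suc k) xs = subst (Eval o _ _) (sym (h-suc o k xs)) (ev-precS (prec-ok o k xs) (g-ok o _))

ifz : ℕ → ℕ → ℕ → ℕ
ifz zero    a _ = a
ifz (suc _) _ b = b

case3 : ℕ → ℕ → ℕ → ℕ → ℕ → ℕ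
case3 0                   a _ _ _ = a
case3 1                   _ b _ _ = b
case3 2                   _ _ c _ = c
case3 (suc (suc (suc _))) _ _ _ d = d

predᴾ : Program 1 (λ _ xs → pred (lookup xs (# 0)))
predᴾ = recᴾ zeroᴾ (varᴾ (# 0)) (λ _ _ → refl) (λ _ _ _ → refl)

+ᴾ : Program 2 (λ _ xs → lookup xs (# 0) + lookup xs (# 1))
+ᴾ = recᴾ (varᴾ (# 0)) (comp₁ sucᴾ (varᴾ (# 1))) (λ _ _ → refl) (λ _ _ _ → refl)

∸ᴾ : Program 2 (λ _ xs → lookup xs (# 0) ∸ lookup xs (# 1))
∸ᴾ = comp₂ flipped (varᴾ (# 1)) (varᴾ (# 0))
  where
  flipped : Program 2 (λ _ xs → lookup xs (# 1) ∸ lookup xs (# 0))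
  flipped = recᴾ (varᴾ (# 0)) (comp₁ predᴾ (varᴾ (# 1))) (λ _ _ → refl)
                 (λ { _ b (a ∷ []) → sym (pred[m∸n]≡m∸[1+n] a b) })

ifzᴾ : Program 3 (λ _ xs → ifz (lookup xs (# 0)) (lookup xs (# 1)) (lookup xs (# 2)))
ifzᴾ = recᴾ (varᴾ (# 0)) (varᴾ (# 3)) (λ _ _ → refl) (λ _ _ _ → refl)

case3ᴾ : ∀ {n h a b c d} → Program n h → Program n a → Program n b → Program n c → Program n d →
         Program n (λ o xs → case3 (h o xs) (a o xs) (b o xs) (c o xs) (d o xs))
case3ᴾ {h = h} {a} {b} {c} {d} H A B C D =
  program-cong (λ o xs → case3-ifz (h o xs) (a o xs) (b o xs) (c o xs) (d o xs))
    (comp₃ ifzᴾ H A (comp₃ ifzᴾ (comp₁ predᴾ H) B (comp₃ ifzᴾ (comp₁ predᴾ (comp₁ predᴾ H)) C D)))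
  where
  case3-ifz : ∀ h a b c d → ifz h a (ifz (pred h) b (ifz (pred (pred h)) c d)) ≡ case3 h a b c d
  case3-ifz 0                   _ _ _ _ = refl
  case3-ifz 1                   _ _ _ _ = refl
  case3-ifz 2                   _ _ _ _ = refl
  case3-ifz (suc (suc (suc _))) _ _ _ _ = refl

triᴾ : Program 1 (λ _ xs → tri (lookup xs (# 0)))
triᴾ = recᴾ zeroᴾ (comp₂ +ᴾ (varᴾ (# 1)) (comp₁ sucᴾ (varᴾ (# 0)))) (λ _ _ → refl) (λ _ _ _ → refl)

cpairᴾ : Program 2 (λ _ xs → cpair (lookup xs (# 0)) (lookup xs (# 1)))
cpairᴾ = comp₂ +ᴾ (comp₁ triᴾ (comp₂ +ᴾ (varᴾ (# 0)) (varᴾ (# 1)))) (varᴾ (# 1))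

iterate-suc : ∀ {A : Set} (f : A → A) x k → iterate f x (suc k) ≡ f (iterate f x k)
iterate-suc f x zero    = refl
iterate-suc f x (suc k) = iterate-suc f (f x) k

iterateᴾ : ∀ {f} → Program 1 f →
           Program 2 (λ o xs → iterate (λ x → f o (x ∷ [])) (lookup xs (# 1)) (lookup xs (# 0)))
iterateᴾ F = recᴾ (varᴾ (# 0)) (comp₁ F (varᴾ (# 1))) (λ _ _ → refl)
                  (λ { o k (x ∷ []) → iterate-suc _ x k })

module _ {A : Set} (f : A → A) (μ : A → ℕ)
         (fixed : ∀ x → μ x ≡ 0 → f x ≡ x)
         (decreasing : ∀ x k → μ x ≡ suc k → μ (f x) ≤ k) where

  iterate-fixed : ∀ x k → μ x ≡ 0 → iterate f x k ≡ x
  iterate-fixed x zero    _      = refl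
  iterate-fixed x (suc k) μx≡0 rewrite fixed x μx≡0 = iterate-fixed x k μx≡0

  iterate-stable : ∀ x k l → μ x ≤ k → μ x ≤ l → iterate f x k ≡ iterate f x l
  iterate-stable x k l μx≤k μx≤l with μ x in eq
  ... | zero = trans (iterate-fixed x k eq) (sym (iterate-fixed x l eq))
  iterate-stable x (suc k) (suc l) (s≤s μx≤k) (s≤s μx≤l) | suc m =
    iterate-stable (f x) k l (≤-trans (decreasing x m eq) μx≤k) (≤-trans (decreasing x m eq) μx≤l)

diagonal : ℕ → ℕ
diagonal zero    = zero
diagonal (suc n) = ifz (tri (suc (diagonal n)) ∸ suc n) (suc (diagonal n)) (diagonal n)

unpair₂ : ℕ → ℕ
unpair₂ n = n ∸ tri (diagonal n)

unpair₁ : ℕ → ℕ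
unpair₁ n = diagonal n ∸ unpair₂ n

diagonal-bounds : ∀ n → tri (diagonal n) ≤ n × n < tri (suc (diagonal n))
diagonal-bounds zero = z≤n , s≤s z≤n
diagonal-bounds (suc n) with diagonal-bounds n | tri (suc (diagonal n)) ∸ suc n in eq
... | _    , n<next | zero  = m∸n≡0⇒m≤n eq , ≤-<-trans n<next (m<m+n _ (s≤s z≤n))
... | lo≤n , _      | suc _ = m≤n⇒m≤1+n lo≤n , m∸n≢0⇒n<m λ eq′ → 0≢1+n (trans (sym eq′) eq)

tri-mono-≤ : ∀ {d e} → d ≤ e → tri d ≤ tri e
tri-mono-≤ {zero}          _         = z≤n
tri-mono-≤ {suc d} {suc e} (s≤s d≤e) = +-mono-≤ (tri-mono-≤ d≤e) (s≤s d≤e)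

diagonal-unique : ∀ {d n} → tri d ≤ n → n < tri (suc d) → diagonal n ≡ d
diagonal-unique {d} {n} lo≤n n<next with diagonal-bounds n | <-cmp (diagonal n) d
... | _ , n<next′ | tri< diag<d _ _ =
  ⊥-elim (<-irrefl refl (<-≤-trans n<next′ (≤-trans (tri-mono-≤ diag<d) lo≤n)))
... | _ | tri≈ _ diag≡d _ = diag≡d
... | lo≤n′ , _ | tri> _ _ d<diag =
  ⊥-elim (<-irrefl refl (<-≤-trans n<next (≤-trans (tri-mono-≤ d<diag) lo≤n′)))

diagonal-cpair : ∀ i j → diagonal (cpair i j) ≡ i + j
diagonal-cpair i j = diagonal-unique (m≤m+n (tri (i + j)) j) (+-monoʳ-< (tri (i + j)) (s≤s (m≤n+m j i)))

unpair₂-cpair : ∀ i j → unpair₂ (cpair i j) ≡ j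
unpair₂-cpair i j rewrite diagonal-cpair i j = m+n∸m≡n (tri (i + j)) j

unpair₁-cpair : ∀ i j → unpair₁ (cpair i j) ≡ i
unpair₁-cpair i j rewrite unpair₂-cpair i j | diagonal-cpair i j = m+n∸n≡m i j

unpair₂-≤ : ∀ n → unpair₂ n ≤ n
unpair₂-≤ n = m∸n≤m n (tri (diagonal n))

j≤cpair : ∀ i j → j ≤ cpair i j
j≤cpair i j = m≤n+m j (tri (i + j))

diagonalᴾ : Program 1 (λ _ xs → diagonal (lookup xs (# 0)))
diagonalᴾ = recᴾ zeroᴾ
  (comp₃ ifzᴾ (comp₂ ∸ᴾ (comp₁ triᴾ (comp₁ sucᴾ (varᴾ (# 1)))) (comp₁ sucᴾ (varᴾ (# 0))))
              (comp₁ sucᴾ (varᴾ (# 1))) (varᴾ (# 1)))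
  (λ _ _ → refl) (λ _ _ _ → refl)

unpair₂ᴾ : Program 1 (λ _ xs → unpair₂ (lookup xs (# 0)))
unpair₂ᴾ = comp₂ ∸ᴾ (varᴾ (# 0)) (comp₁ triᴾ diagonalᴾ)

unpair₁ᴾ : Program 1 (λ _ xs → unpair₁ (lookup xs (# 0)))
unpair₁ᴾ = comp₂ ∸ᴾ diagonalᴾ unpair₂ᴾ

-- Direction 0 enters the tail of a successor name, direction 1+i the i-th
-- component of a limit name; childIndex d j is the position, in a name, of
-- entry j of its d-child.
childIndex : ℕ → ℕ → ℕ
childIndex d j = ifz d (suc j) (suc (cpair (pred d) j))

-- A stack codes a list of directions, 0 being the empty one.
push : ℕ → ℕ → ℕ
push d s = suc (cpair d s)

popStep : ℕ → ℕ
popStep t = ifz (unpair₁ t) t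
  (cpair (unpair₂ (pred (unpair₁ t))) (childIndex (unpair₁ (pred (unpair₁ t))) (unpair₂ t)))

-- address s j is the position, in the whole name, of entry j of the subname
-- reached along s; s pops suffice as each pop decreases the stack code.
address : ℕ → ℕ → ℕ
address s j = unpair₂ (iterate popStep (cpair s j) s)

popStep-empty : ∀ t → unpair₁ t ≡ 0 → popStep t ≡ t
popStep-empty t s≡0 rewrite s≡0 = refl

popStep-decreasing : ∀ t k → unpair₁ t ≡ suc k → unpair₁ (popStep t) ≤ k
popStep-decreasing t k s≡1+k
  rewrite s≡1+k | unpair₁-cpair (unpair₂ k) (childIndex (unpair₁ k) (unpair₂ t)) = unpair₂-≤ k

popStep-push : ∀ d s j → popStep (cpair (push d s) j) ≡ cpair s (childIndex d j)
popStep-push d s j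
  rewrite unpair₁-cpair (push d s) j | unpair₂-cpair (push d s) j
        | unpair₁-cpair d s | unpair₂-cpair d s = refl

address-root : ∀ j → address 0 j ≡ j
address-root j = unpair₂-cpair 0 j

address-push : ∀ d s j → address (push d s) j ≡ address s (childIndex d j)
address-push d s j = cong unpair₂ (begin
  iterate popStep (popStep (cpair (push d s) j)) (cpair d s)
    ≡⟨ cong (λ t → iterate popStep t (cpair d s)) (popStep-push d s j) ⟩
  iterate popStep (cpair s (childIndex d j)) (cpair d s)
    ≡⟨ iterate-stable popStep unpair₁ popStep-empty popStep-decreasing _ _ _ (bound (j≤cpair d s)) (bound ≤-refl) ⟩
  iterate popStep (cpair s (childIndex d j)) s ∎)
  where
  open ≡-Reasoning
  bound : ∀ {l} → s ≤ l → unpair₁ (cpair s (childIndex d j)) ≤ l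
  bound {l} s≤l = subst (_≤ l) (sym (unpair₁-cpair s (childIndex d j))) s≤l

childIndexᴾ : Program 2 (λ _ xs → childIndex (lookup xs (# 0)) (lookup xs (# 1)))
childIndexᴾ = comp₃ ifzᴾ (varᴾ (# 0)) (comp₁ sucᴾ (varᴾ (# 1)))
  (comp₁ sucᴾ (comp₂ cpairᴾ (comp₁ predᴾ (varᴾ (# 0))) (varᴾ (# 1))))

pushᴾ : Program 2 (λ _ xs → push (lookup xs (# 0)) (lookup xs (# 1)))
pushᴾ = comp₁ sucᴾ cpairᴾ

popStepᴾ : Program 1 (λ _ xs → popStep (lookup xs (# 0)))
popStepᴾ = comp₃ ifzᴾ (comp₁ unpair₁ᴾ (varᴾ (# 0))) (varᴾ (# 0))
  (comp₂ cpairᴾ (comp₁ unpair₂ᴾ top) (comp₂ childIndexᴾ (comp₁ unpair₁ᴾ top) unpair₂ᴾ))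
  where
  top : Program 1 (λ _ xs → pred (unpair₁ (lookup xs (# 0))))
  top = comp₁ predᴾ unpair₁ᴾ

addressᴾ : Program 2 (λ _ xs → address (lookup xs (# 0)) (lookup xs (# 1)))
addressᴾ = comp₁ unpair₂ᴾ (comp₂ (iterateᴾ popStepᴾ) (varᴾ (# 0)) cpairᴾ)

⟪⟫-even : ∀ p q k → ⟪ p , q ⟫ (k + k) ≡ p k
⟪⟫-even p q zero = refl
⟪⟫-even p q (suc k) rewrite +-suc k k = ⟪⟫-even (tl p) (tl q) k

⟪⟫-odd : ∀ p q k → ⟪ p , q ⟫ (suc (k + k)) ≡ q k
⟪⟫-odd p q zero = refl
⟪⟫-odd p q (suc k) rewrite +-suc k k = ⟪⟫-odd (tl p) (tl q) k

-- A machine state ⟨a,⟨b,m⟩⟩ holds stacks a, b locating the current subnames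
-- of p and q, and the index m of the entry still to be produced.
state : ℕ → ℕ → ℕ → ℕ
state a b m = cpair a (cpair b m)

stackL stackR index : ℕ → ℕ
stackL t = unpair₁ t
stackR t = unpair₁ (unpair₂ t)
index  t = unpair₂ (unpair₂ t)

stackL-state : ∀ a b m → stackL (state a b m) ≡ a
stackL-state a b m = unpair₁-cpair a (cpair b m)

stackR-state : ∀ a b m → stackR (state a b m) ≡ b
stackR-state a b m rewrite unpair₂-cpair a (cpair b m) = unpair₁-cpair b m

index-state : ∀ a b m → index (state a b m) ≡ m
index-state a b m rewrite unpair₂-cpair a (cpair b m) = unpair₂-cpair b m

headL headR : Baire → ℕ → ℕ
headL o t = o (address (stackL t) 0 + address (stackL t) 0)
headR o t = o (suc (address (stackR t) 0 + address (stackR t) 0))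

minHead : ℕ → ℕ → ℕ
minHead h h′ = case3 h 0 (case3 h′ 0 1 2 0) 2 0

descend : ℕ → ℕ → ℕ → ℕ → ℕ → ℕ
descend h h′ a b n = case3 h halt
  (case3 h′ halt (state (push 0 a) (push 0 b) n)
                 (state a (push (suc (unpair₁ n)) b) (unpair₂ n)) halt)
  (state (push (suc (unpair₁ n)) a) b (unpair₂ n)) halt
  where
  halt : ℕ
  halt = state a b 0

step : Baire → ℕ → ℕ
step o t = ifz (index t) t (descend (headL o t) (headR o t) (stackL t) (stackR t) (pred (index t)))

run : Baire → ℕ → ℕ → Baire
run o a b n = minHead (headL o t) (headR o t)
  where
  t : ℕ
  t = iterate (step o) (state a b n) n

stateᴾ : ∀ {n a b m} → Program n a → Program n b → Program n m →
         Program n (λ o xs → state (a o xs) (b o xs) (m o xs))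
stateᴾ A B M = comp₂ cpairᴾ A (comp₂ cpairᴾ B M)

stackLᴾ : Program 1 (λ _ xs → stackL (lookup xs (# 0)))
stackLᴾ = unpair₁ᴾ

stackRᴾ : Program 1 (λ _ xs → stackR (lookup xs (# 0)))
stackRᴾ = comp₁ unpair₁ᴾ unpair₂ᴾ

indexᴾ : Program 1 (λ _ xs → index (lookup xs (# 0)))
indexᴾ = comp₁ unpair₂ᴾ unpair₂ᴾ

headLᴾ : Program 1 (λ o xs → headL o (lookup xs (# 0)))
headLᴾ = comp₁ oracleᴾ (comp₂ +ᴾ rootL rootL)
  where
  rootL : Program 1 (λ _ xs → address (stackL (lookup xs (# 0))) 0)
  rootL = comp₂ addressᴾ stackLᴾ zeroᴾ

headRᴾ : Program 1 (λ o xs → headR o (lookup xs (# 0)))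
headRᴾ = comp₁ oracleᴾ (comp₁ sucᴾ (comp₂ +ᴾ rootR rootR))
  where
  rootR : Program 1 (λ _ xs → address (stackR (lookup xs (# 0))) 0)
  rootR = comp₂ addressᴾ stackRᴾ zeroᴾ

minHeadᴾ : ∀ {n h h′} → Program n h → Program n h′ → Program n (λ o xs → minHead (h o xs) (h′ o xs))
minHeadᴾ {n} H H′ = case3ᴾ H zeroᴾ (case3ᴾ H′ zeroᴾ one two zeroᴾ) two zeroᴾ
  where
  one : Program n (λ _ _ → 1)
  one = comp₁ sucᴾ zeroᴾ
  two : Program n (λ _ _ → 2)
  two = comp₁ sucᴾ one

stepᴾ : Program 1 (λ o xs → step o (lookup xs (# 0)))
stepᴾ = comp₃ ifzᴾ indexᴾ (varᴾ (# 0))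
  (case3ᴾ headLᴾ halt
     (case3ᴾ headRᴾ halt (stateᴾ (comp₂ pushᴾ zeroᴾ stackLᴾ) (comp₂ pushᴾ zeroᴾ stackRᴾ) m)
                        (stateᴾ stackLᴾ (comp₂ pushᴾ i+1 stackRᴾ) k) halt)
     (stateᴾ (comp₂ pushᴾ i+1 stackLᴾ) stackRᴾ k) halt)
  where
  halt : Program 1 (λ _ xs → state (stackL (lookup xs (# 0))) (stackR (lookup xs (# 0))) 0)
  halt = stateᴾ stackLᴾ stackRᴾ zeroᴾ
  m : Program 1 (λ _ xs → pred (index (lookup xs (# 0))))
  m = comp₁ predᴾ indexᴾ
  i+1 : Program 1 (λ _ xs → suc (unpair₁ (pred (index (lookup xs (# 0))))))
  i+1 = comp₁ sucᴾ (comp₁ unpair₁ᴾ m)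
  k : Program 1 (λ _ xs → unpair₂ (pred (index (lookup xs (# 0)))))
  k = comp₁ unpair₂ᴾ m

runᴾ : Program 1 (λ o xs → run o 0 0 (lookup xs (# 0)))
runᴾ = comp₁ (minHeadᴾ headLᴾ headRᴾ)
  (comp₂ (iterateᴾ stepᴾ) (varᴾ (# 0)) (stateᴾ zeroᴾ zeroᴾ (varᴾ (# 0))))

step-halted : ∀ o t → index t ≡ 0 → step o t ≡ t
step-halted o t m≡0 rewrite m≡0 = refl

descend-index : ∀ h h′ a b n → index (descend h h′ a b n) ≤ n
descend-index 0 _ a b n                         rewrite index-state a b 0 = z≤n
descend-index 1 0 a b n                         rewrite index-state a b 0 = z≤n
descend-index 1 1 a b n                         rewrite index-state (push 0 a) (push 0 b) n = ≤-refl
descend-index 1 2 a b n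
  rewrite index-state a (push (suc (unpair₁ n)) b) (unpair₂ n) = unpair₂-≤ n
descend-index 1 (suc (suc (suc _))) a b n       rewrite index-state a b 0 = z≤n
descend-index 2 _ a b n
  rewrite index-state (push (suc (unpair₁ n)) a) b (unpair₂ n) = unpair₂-≤ n
descend-index (suc (suc (suc _))) _ a b n       rewrite index-state a b 0 = z≤n

step-running : ∀ o t {n} → index t ≡ suc n →
               step o t ≡ descend (headL o t) (headR o t) (stackL t) (stackR t) n
step-running o t m≡1+n rewrite m≡1+n = refl

step-decreasing : ∀ o t k → index t ≡ suc k → index (step o t) ≤ k
step-decreasing o t k m≡1+k =
  subst (λ t′ → index t′ ≤ k) (sym (step-running o t m≡1+k))
    (descend-index (headL o t) (headR o t) (stackL t) (stackR t) k)

run-suc : ∀ o a b n a′ b′ n′ → step o (state a b (suc n)) ≡ state a′ b′ n′ → n′ ≤ n →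
          run o a b (suc n) ≡ run o a′ b′ n′
run-suc o a b n a′ b′ n′ step≡ n′≤n = cong (λ t → minHead (headL o t) (headR o t)) (begin
  iterate (step o) (step o (state a b (suc n))) n ≡⟨ cong (λ t → iterate (step o) t n) step≡ ⟩
  iterate (step o) (state a′ b′ n′) n            ≡⟨ iterate-stable (step o) index (step-halted o)
                                                      (step-decreasing o) _ n n′ (bound n′≤n) (bound ≤-refl) ⟩
  iterate (step o) (state a′ b′ n′) n′           ∎)
  where
  open ≡-Reasoning
  bound : ∀ {l} → n′ ≤ l → index (state a′ b′ n′) ≤ l
  bound {l} n′≤l = subst (_≤ l) (sym (index-state a′ b′ n′)) n′≤l

NameOf-≗ : ∀ {F G α} → F ≗ G → NameOf F α → NameOf G α
NameOf-≗ F≗G (nm-zero hd≡0) = nm-zero (trans (sym (F≗G 0)) hd≡0)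
NameOf-≗ F≗G (nm-suc hd≡1 name) = nm-suc (trans (sym (F≗G 0)) hd≡1) (NameOf-≗ (F≗G ∘ suc) name)
NameOf-≗ F≗G (nm-lim hd≡2 names) =
  nm-lim (trans (sym (F≗G 0)) hd≡2) λ i → NameOf-≗ (λ k → F≗G (suc (cpair i k))) (names i)

tracks-child : ∀ {F : Baire} p a d → F ≗ p ∘ address a → F ∘ childIndex d ≗ p ∘ address (push d a)
tracks-child p a d F≗ j = trans (F≗ (childIndex d j)) (cong p (sym (address-push d a j)))

infixl 30 _⊓ₒ_

_⊓ₒ_ : Ord → Ord → Ord
zero  ⊓ₒ β     = zero
lim f ⊓ₒ β     = lim (λ i → f i ⊓ₒ β)
suc α ⊓ₒ zero  = zero
suc α ⊓ₒ suc β = suc (α ⊓ₒ β)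
suc α ⊓ₒ lim g = lim (λ i → suc α ⊓ₒ g i)

⊓ₒ-≤ˡ : ∀ α β → α ⊓ₒ β ≤ₒ α
⊓ₒ-≤ˡ zero    β       = z≤
⊓ₒ-≤ˡ (lim f) β       = lim≤ λ i → ≤lim i (⊓ₒ-≤ˡ (f i) β)
⊓ₒ-≤ˡ (suc α) zero    = z≤
⊓ₒ-≤ˡ (suc α) (suc β) = s≤s (⊓ₒ-≤ˡ α β)
⊓ₒ-≤ˡ (suc α) (lim g) = lim≤ λ i → ⊓ₒ-≤ˡ (suc α) (g i)

⊓ₒ-≤ʳ : ∀ α β → α ⊓ₒ β ≤ₒ β
⊓ₒ-≤ʳ zero    β       = z≤
⊓ₒ-≤ʳ (lim f) β       = lim≤ λ i → ⊓ₒ-≤ʳ (f i) β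
⊓ₒ-≤ʳ (suc α) zero    = z≤
⊓ₒ-≤ʳ (suc α) (suc β) = s≤s (⊓ₒ-≤ʳ α β)
⊓ₒ-≤ʳ (suc α) (lim g) = lim≤ λ i → ≤lim i (⊓ₒ-≤ʳ (suc α) (g i))

⊓ₒ-sel : ExcludedMiddle 0ℓ → ∀ α β → α ≤ₒ α ⊓ₒ β ⊎ β ≤ₒ α ⊓ₒ β
⊓ₒ-sel em zero    β    = inj₁ z≤
⊓ₒ-sel em (suc α) zero = inj₂ z≤
⊓ₒ-sel em (suc α) (suc β) with ⊓ₒ-sel em α β
... | inj₁ α≤ = inj₁ (s≤s α≤)
... | inj₂ β≤ = inj₂ (s≤s β≤)
⊓ₒ-sel em (lim f) β with em {Σ ℕ λ i → β ≤ₒ f i ⊓ₒ β}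
... | yes (i , β≤) = inj₂ (≤lim i β≤)
... | no ¬β≤ = inj₁ (lim≤ λ i → ≤lim i (left i))
  where
  left : ∀ i → f i ≤ₒ f i ⊓ₒ β
  left i with ⊓ₒ-sel em (f i) β
  ... | inj₁ fi≤ = fi≤
  ... | inj₂ β≤  = ⊥-elim (¬β≤ (i , β≤))
⊓ₒ-sel em (suc α) (lim g) with em {Σ ℕ λ i → suc α ≤ₒ suc α ⊓ₒ g i}
... | yes (i , α≤) = inj₁ (≤lim i α≤)
... | no ¬α≤ = inj₂ (lim≤ λ i → ≤lim i (right i))
  where
  right : ∀ i → g i ≤ₒ suc α ⊓ₒ g i
  right i with ⊓ₒ-sel em (suc α) (g i)
  ... | inj₁ α≤  = ⊥-elim (¬α≤ (i , α≤))
  ... | inj₂ gi≤ = gi≤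

⊓ₒ-isMin : ExcludedMiddle 0ℓ → ∀ α β → IsMin (α ⊓ₒ β) α β
⊓ₒ-isMin em α β with ⊓ₒ-sel em α β
... | inj₁ α≤ = inj₁ (⊓ₒ-≤ˡ α β , α≤) , ⊓ₒ-≤ˡ α β , ⊓ₒ-≤ʳ α β
... | inj₂ β≤ = inj₂ (⊓ₒ-≤ʳ α β , β≤) , ⊓ₒ-≤ˡ α β , ⊓ₒ-≤ʳ α β

module _ (p q : Baire) where

  private
    o : Baire
    o = ⟪ p , q ⟫

  headL-state : ∀ a b m → headL o (state a b m) ≡ p (address a 0)
  headL-state a b m rewrite stackL-state a b m = ⟪⟫-even p q (address a 0)

  headR-state : ∀ a b m → headR o (state a b m) ≡ q (address b 0)
  headR-state a b m rewrite stackR-state a b m = ⟪⟫-odd p q (address b 0)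

  step-state : ∀ a b n → step o (state a b (suc n)) ≡ descend (p (address a 0)) (q (address b 0)) a b n
  step-state a b n = begin
    step o t
      ≡⟨ step-running o t (index-state a b (suc n)) ⟩
    descend (headL o t) (headR o t) (stackL t) (stackR t) n
      ≡⟨ cong₂ (λ h h′ → descend h h′ (stackL t) (stackR t) n) (headL-state a b (suc n)) (headR-state a b (suc n)) ⟩
    descend (p (address a 0)) (q (address b 0)) (stackL t) (stackR t) n
      ≡⟨ cong₂ (λ a′ b′ → descend (p (address a 0)) (q (address b 0)) a′ b′ n) (stackL-state a b (suc n)) (stackR-state a b (suc n)) ⟩
    descend (p (address a 0)) (q (address b 0)) a b n ∎
    where
    open ≡-Reasoning
    t : ℕ
    t = state a b (suc n)

  run-zero : ∀ a b → run o a b 0 ≡ minHead (p (address a 0)) (q (address b 0))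
  run-zero a b = cong₂ minHead (headL-state a b 0) (headR-state a b 0)

  run-suc-suc : ∀ a b n → p (address a 0) ≡ 1 → q (address b 0) ≡ 1 →
                run o a b (suc n) ≡ run o (push 0 a) (push 0 b) n
  run-suc-suc a b n pa≡1 qb≡1 = run-suc o a b n (push 0 a) (push 0 b) n descends ≤-refl
    where
    descends : step o (state a b (suc n)) ≡ state (push 0 a) (push 0 b) n
    descends rewrite step-state a b n | pa≡1 | qb≡1 = refl

  run-lim-left : ∀ a b i k → p (address a 0) ≡ 2 →
                 run o a b (suc (cpair i k)) ≡ run o (push (suc i) a) b k
  run-lim-left a b i k pa≡2 = run-suc o a b (cpair i k) (push (suc i) a) b k descends (j≤cpair i k)
    where
    descends : step o (state a b (suc (cpair i k))) ≡ state (push (suc i) a) b k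
    descends rewrite step-state a b (cpair i k) | pa≡2 | unpair₁-cpair i k | unpair₂-cpair i k = refl

  run-lim-right : ∀ a b i k → p (address a 0) ≡ 1 → q (address b 0) ≡ 2 →
                  run o a b (suc (cpair i k)) ≡ run o a (push (suc i) b) k
  run-lim-right a b i k pa≡1 qb≡2 = run-suc o a b (cpair i k) a (push (suc i) b) k descends (j≤cpair i k)
    where
    descends : step o (state a b (suc (cpair i k))) ≡ state a (push (suc i) b) k
    descends rewrite step-state a b (cpair i k) | pa≡1 | qb≡2 | unpair₁-cpair i k | unpair₂-cpair i k = refl

  run-head : ∀ {F G : Baire} a b → F ≗ p ∘ address a → G ≗ q ∘ address b →
             run o a b 0 ≡ minHead (hd F) (hd G)
  run-head a b F≗ G≗ = trans (run-zero a b) (sym (cong₂ minHead (F≗ 0) (G≗ 0)))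

  run-name : ∀ {F G : Baire} {α β} a b → F ≗ p ∘ address a → G ≗ q ∘ address b →
             NameOf F α → NameOf G β → NameOf (run o a b) (α ⊓ₒ β)
  run-name a b F≗ G≗ (nm-zero F0) _ = nm-zero (trans (run-head a b F≗ G≗) (cong₂ minHead F0 refl))
  run-name a b F≗ G≗ (nm-lim F2 names) nG =
    nm-lim (trans (run-head a b F≗ G≗) (cong₂ minHead F2 refl)) λ i →
      NameOf-≗ (λ k → sym (run-lim-left a b i k (trans (sym (F≗ 0)) F2)))
        (run-name (push (suc i) a) b (tracks-child p a (suc i) F≗) G≗ (names i) nG)
  run-name a b F≗ G≗ (nm-suc F1 _) (nm-zero G0) =
    nm-zero (trans (run-head a b F≗ G≗) (cong₂ minHead F1 G0))
  run-name a b F≗ G≗ (nm-suc F1 nF) (nm-suc G1 nG) =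
    nm-suc (trans (run-head a b F≗ G≗) (cong₂ minHead F1 G1))
      (NameOf-≗ (λ k → sym (run-suc-suc a b k (trans (sym (F≗ 0)) F1) (trans (sym (G≗ 0)) G1)))
        (run-name (push 0 a) (push 0 b) (tracks-child p a 0 F≗) (tracks-child q b 0 G≗) nF nG))
  run-name a b F≗ G≗ nF@(nm-suc F1 _) (nm-lim G2 names) =
    nm-lim (trans (run-head a b F≗ G≗) (cong₂ minHead F1 G2)) λ i →
      NameOf-≗ (λ k → sym (run-lim-right a b i k (trans (sym (F≗ 0)) F1) (trans (sym (G≗ 0)) G2)))
        (run-name a (push (suc i) b) F≗ (tracks-child q b (suc i) G≗) nF (names i))

theorem23 : ExcludedMiddle 0ℓ →
    Σ (Code 1) λ e →
      ∀ p q α β → NameOf p α → NameOf q β →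
        Σ Baire λ r → Computes e ⟪ p , q ⟫ r ×
          Σ Ord λ γ → NameOf r γ × IsMin γ α β
theorem23 em = proj₁ runᴾ , λ p q α β p-names q-names →
  run ⟪ p , q ⟫ 0 0 , (λ n → proj₂ runᴾ ⟪ p , q ⟫ (n ∷ [])) ,
  α ⊓ₒ β , run-name p q 0 0 (at-root p) (at-root q) p-names q-names , ⊓ₒ-isMin em α β
  where
  at-root : ∀ r → r ≗ r ∘ address 0
  at-root r k = cong r (sym (address-root k))
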